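{- Let $F$ be a filter in the Ignatiev algebra $\mathfrak{I}$, and let $\vec\alpha=\vec\alpha_F$, i.e. $\alpha_i=\sup\{\beta_i+1:\vec\beta\in F\}$ for each $i\in\omega$. Then for every $i\in\omega$ one of the following holds: - $\alpha_i$ is a limit ordinal and $\alpha_{i+1}\le\ell(\alpha_i)$; or - $\alpha_i=\alpha_i'+1$ for some $\alpha_i'$, and $\alpha_{i+1}\le\ell(\alpha_i')+1$.
   Context: Ordinal conventions: $\varepsilon_0$ is the least ordinal $\varepsilon$ with $\omega^\varepsilon=\varepsilon$. For an ordinal $\alpha>0$, $\ell(\alpha)$ is the unique $\beta$ such that $\alpha=\gamma+\omega^\beta$ for some $\gamma$. Also $\ell(0)=0$. Ignatiev sequences: $I$ is the set of sequences $\vec\alpha=(\alpha_i)_{i\in\omega}$ of ordinals $<\varepsilon_0$ with $\alpha_{i+1}\le\ell(\alpha_i)$ for all $i$. Ignatiev algebra $\mathfrak{I}$: its universe is $I$. The order is $\vec\alpha\le_\mathfrak{I}\vec\beta$ iff $\alpha_i\ge\beta_i$ for all $i$. The meet $\vec\alpha\land_\mathfrak{I}\vec\beta$ is the $\le_\mathfrak{I}$-greatest lower bound. Explicitly, put $\gamma_i=\max(\alpha_i,\beta_i)$ and take $N$ with $\gamma_i=0$ for $i\ge N$. Then $\vec\delta=\vec\alpha\land_\mathfrak{I}\vec\beta$ has $\delta_i=0$ for $i\ge N$, and downward for $i<N$: $\delta_i=\gamma_i$ if $\ell(\gamma_i)\ge\delta_{i+1}$, and $\delta_i=\gamma_i+\omega^{\delta_{i+1}}$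 otherwise. Filters: a filter in $\mathfrak{I}$ is a nonempty $F\subseteq I$ that is upward closed under $\le_\mathfrak{I}$ and closed under $\land_\mathfrak{I}$. For a filter $F$, the sequence $\vec\alpha_F$ consists of ordinals $\le\varepsilon_0$, each $>0$. -}

module Defs where

open import Data.Nat using (ℕ; zero; suc)
open import Data.Product using (Σ; _×_; _,_; ∃)
open import Data.Sum using (_⊎_)
open import Data.Unit using (⊤)
open import Relation.Binary.PropositionalEquality using (_≡_; _≢_)

-- Ordinals below ε₀ in Cantor normal form.
-- A raw term is either 0 or  ω^a + b .
data Tm : Set where
  𝟎    : Tm
  ω^_+_ : Tm → Tm → Tm

infixr 30 ω^_+_

-- Lexicographic strict order (correct on Cantor-normal-form terms).
data _<ₒ_ : Tm → Tm → Set where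
  <-zero : ∀ {a b} → 𝟎 <ₒ ω^ a + b
  <-exp  : ∀ {a b c d} → a <ₒ c → ω^ a + b <ₒ ω^ c + d
  <-tail : ∀ {a b d} → b <ₒ d → ω^ a + b <ₒ ω^ a + d

_≤ₒ_ : Tm → Tm → Set
a ≤ₒ b = (a <ₒ b) ⊎ (a ≡ b)

data IsCNF : Tm → Set where
  cnf-zero : IsCNF 𝟎
  cnf-one  : ∀ {a} → IsCNF a → IsCNF (ω^ a + 𝟎)
  cnf-more : ∀ {a c d} → IsCNF a → IsCNF (ω^ c + d) → c ≤ₒ a →
             IsCNF (ω^ a + ω^ c + d)

ℓ : Tm → Tm
ℓ 𝟎 = 𝟎
ℓ (ω^ a + 𝟎) = a
ℓ (ω^ a + (ω^ c + d)) = ℓ (ω^ c + d)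

succ : Tm → Tm
succ 𝟎 = ω^ 𝟎 + 𝟎
succ (ω^ a + b) = ω^ a + succ b

data Ō : Set where
  fin : Tm → Ō
  ε₀  : Ō

data _≤̄_ : Ō → Ō → Set where
  fin≤fin : ∀ {a b} → a ≤ₒ b → fin a ≤̄ fin b
  fin≤ε₀  : ∀ {a} → fin a ≤̄ ε₀
  ε₀≤ε₀   : ε₀ ≤̄ ε₀

-- ℓ extended to ε₀: ε₀ = ω^ε₀, so ℓ(ε₀) = ε₀.
ℓ̄ : Ō → Ō
ℓ̄ (fin a) = fin (ℓ a)
ℓ̄ ε₀ = ε₀

IsLimit : Ō → Set
IsLimit x = (x ≢ fin 𝟎) × (∀ β → IsCNF β → x ≢ fin (succ β))

record ISeq : Set where
  field
    seq    : ℕ → Tm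
    cnf    : ∀ i → IsCNF (seq i)
    ladder : ∀ i → seq (suc i) ≤ₒ ℓ (seq i)
open ISeq public

_≤𝔍_ : ISeq → ISeq → Set
α ≤𝔍 β = ∀ i → seq β i ≤ₒ seq α i

IsMeet : ISeq → ISeq → ISeq → Set
IsMeet δ α β = (δ ≤𝔍 α) × (δ ≤𝔍 β) ×
               (∀ γ → γ ≤𝔍 α → γ ≤𝔍 β → γ ≤𝔍 δ)

record IsFilter (F : ISeq → Set) : Set₁ where
  field
    nonempty  : ∃ F
    upward    : ∀ α β → α ≤𝔍 β → F α → F β
    meet-closed : ∀ α β δ → F α → F β → IsMeet δ α β → F δ

IsNormalŌ : Ō → Set
IsNormalŌ (fin a) = IsCNF a
IsNormalŌ ε₀ = ⊤

IsSupAt : (F : ISeq → Set) → ℕ → Ō → Set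
IsSupAt F i x = IsNormalŌ x ×
  (∀ β → F β → fin (succ (seq β i)) ≤̄ x) ×
  (∀ u → IsNormalŌ u → (∀ β → F β → fin (succ (seq β i)) ≤̄ u) → x ≤̄ u)

module Submission where

-- Let a = α_i be the supremum of the i-th coordinates over a filter F.
-- The key point is that two members β, γ of F can be merged: their meet δ
-- lies in F, dominates β at i and γ at i+1, and is an Ignatiev sequence, so
-- γ_{i+1} ≤ δ_{i+1} ≤ ℓ(δ_i) with δ_i < a.  Hence every β_i is bounded by
-- some x < a with ℓ(x) ≥ γ_{i+1}.
--  * If a = a′+1 and γ_{i+1} > ℓ(a′), such an x can never equal a′, so all
--    β_i < a′, contradicting the minimality of the supremum a.
--  * If a is a limit (ℓ(a) ≠ 0) and γ_{i+1} ≥ ℓ(a), such an x can never lie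
--    strictly between init(a) (a with its last term removed) and a, since
--    then ℓ(x) < ℓ(a); so all β_i ≤ init(a) and a ≤ init(a)+1 < a.

open import Defs
open import Data.Nat using (ℕ; zero; suc; _≤_; _+_; _∸_; _⊔_; pred; z≤n; s≤s)
import Data.Nat.Properties as ℕ
open import Data.Product using (Σ; _×_; _,_; proj₁; proj₂)
open import Data.Sum using (_⊎_; inj₁; inj₂)
open import Data.Empty using (⊥; ⊥-elim)
open import Relation.Binary.PropositionalEquality
  using (_≡_; _≢_; refl; sym; trans; cong; subst)

<-irrefl : ∀ {a} → a <ₒ a → ⊥
<-irrefl (<-exp p) = <-irrefl p
<-irrefl (<-tail p) = <-irrefl p

<-trans : ∀ {a b c} → a <ₒ b → b <ₒ c → a <ₒ c
<-trans <-zero (<-exp q) = <-zero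
<-trans <-zero (<-tail q) = <-zero
<-trans (<-exp p) (<-exp q) = <-exp (<-trans p q)
<-trans (<-exp p) (<-tail q) = <-exp p
<-trans (<-tail p) (<-exp q) = <-exp q
<-trans (<-tail p) (<-tail q) = <-tail (<-trans p q)

≤-trans : ∀ {a b c} → a ≤ₒ b → b ≤ₒ c → a ≤ₒ c
≤-trans (inj₁ p) (inj₁ q) = inj₁ (<-trans p q)
≤-trans (inj₁ p) (inj₂ refl) = inj₁ p
≤-trans (inj₂ refl) q = q

<-≤-trans : ∀ {a b c} → a <ₒ b → b ≤ₒ c → a <ₒ c
<-≤-trans p (inj₁ q) = <-trans p q
<-≤-trans p (inj₂ refl) = p

≤-<-trans : ∀ {a b c} → a ≤ₒ b → b <ₒ c → a <ₒ c
≤-<-trans (inj₁ p) q = <-trans p q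
≤-<-trans (inj₂ refl) q = q

<⇒≱ : ∀ {a b} → a <ₒ b → b ≤ₒ a → ⊥
<⇒≱ p q = <-irrefl (<-≤-trans p q)

0≤ : ∀ a → 𝟎 ≤ₒ a
0≤ 𝟎 = inj₂ refl
0≤ (ω^ a + b) = inj₁ <-zero

above⇒≢𝟎 : ∀ {a b} → a <ₒ b → b ≢ 𝟎
above⇒≢𝟎 () refl

tail≤ : ∀ {a b d} → b ≤ₒ d → ω^ a + b ≤ₒ ω^ a + d
tail≤ (inj₁ p) = inj₁ (<-tail p)
tail≤ (inj₂ refl) = inj₂ refl

<-or-≥ : ∀ a b → a <ₒ b ⊎ b ≤ₒ a
<-or-≥ 𝟎 𝟎 = inj₂ (inj₂ refl)
<-or-≥ 𝟎 (ω^ c + d) = inj₁ <-zero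
<-or-≥ (ω^ a + b) 𝟎 = inj₂ (inj₁ <-zero)
<-or-≥ (ω^ a + b) (ω^ c + d) with <-or-≥ a c
... | inj₁ p = inj₁ (<-exp p)
... | inj₂ (inj₁ p) = inj₂ (inj₁ (<-exp p))
... | inj₂ (inj₂ refl) with <-or-≥ b d
...   | inj₁ q = inj₁ (<-tail q)
...   | inj₂ q = inj₂ (tail≤ q)

ω^≤ : ∀ {d e f} → d ≤ₒ e → ω^ d + 𝟎 ≤ₒ ω^ e + f
ω^≤ (inj₁ p) = inj₁ (<-exp p)
ω^≤ {f = f} (inj₂ refl) = tail≤ (0≤ f)

cnf-head : ∀ {a b} → IsCNF (ω^ a + b) → IsCNF a
cnf-head (cnf-one h) = h
cnf-head (cnf-more h _ _) = h

cnf-tail : ∀ {a b} → IsCNF (ω^ a + b) → IsCNF b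
cnf-tail (cnf-one h) = cnf-zero
cnf-tail (cnf-more _ h _) = h

-- "ω^a + x is in normal form": x is 0 or its leading exponent is ≤ a.
data LeadsBelow (a : Tm) : Tm → Set where
  lb-zero : LeadsBelow a 𝟎
  lb-cons : ∀ {c d} → c ≤ₒ a → LeadsBelow a (ω^ c + d)

cnf-cons : ∀ {a x} → IsCNF a → IsCNF x → LeadsBelow a x → IsCNF (ω^ a + x)
cnf-cons ha cnf-zero lb-zero = cnf-one ha
cnf-cons ha hx (lb-cons c≤a) = cnf-more ha hx c≤a

cnf-leads : ∀ {a b} → IsCNF (ω^ a + b) → LeadsBelow a b
cnf-leads (cnf-one _) = lb-zero
cnf-leads (cnf-more _ _ c≤a) = lb-cons c≤a

ℓ-cons : ∀ a x → x ≢ 𝟎 → ℓ (ω^ a + x) ≡ ℓ x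
ℓ-cons a 𝟎 x≢0 = ⊥-elim (x≢0 refl)
ℓ-cons a (ω^ c + d) x≢0 = refl

ℓ-cnf : ∀ {x} → IsCNF x → IsCNF (ℓ x)
ℓ-cnf cnf-zero = cnf-zero
ℓ-cnf (cnf-one h) = h
ℓ-cnf (cnf-more _ h _) = ℓ-cnf h

ℓ≤lead : ∀ {a b} → IsCNF (ω^ a + b) → ℓ (ω^ a + b) ≤ₒ a
ℓ≤lead (cnf-one _) = inj₂ refl
ℓ≤lead (cnf-more _ hcd c≤a) = ≤-trans (ℓ≤lead hcd) c≤a

succ≢𝟎 : ∀ t → succ t ≢ 𝟎
succ≢𝟎 𝟎 ()
succ≢𝟎 (ω^ a + b) ()

ℓ-succ : ∀ t → ℓ (succ t) ≡ 𝟎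
ℓ-succ 𝟎 = refl
ℓ-succ (ω^ a + b) = trans (ℓ-cons a (succ b) (succ≢𝟎 b)) (ℓ-succ b)

succ-cnf : ∀ {x} → IsCNF x → IsCNF (succ x)
succ-cnf cnf-zero = cnf-one cnf-zero
succ-cnf (cnf-one {a} h) = cnf-more h (cnf-one cnf-zero) (0≤ a)
succ-cnf (cnf-more h hcd c≤a) = cnf-more h (succ-cnf hcd) c≤a

<succ : ∀ x → x <ₒ succ x
<succ 𝟎 = <-zero
<succ (ω^ a + b) = <-tail (<succ b)

succ-least : ∀ {x y} → x <ₒ y → succ x ≤ₒ y
succ-least {𝟎} {ω^ 𝟎 + d} <-zero = tail≤ (0≤ d)
succ-least {𝟎} {ω^ (ω^ a + b) + d} <-zero = inj₁ (<-exp <-zero)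
succ-least (<-exp p) = inj₁ (<-exp p)
succ-least (<-tail p) = tail≤ (succ-least p)

<succ⇒≤ : ∀ {x y} → x <ₒ succ y → x ≤ₒ y
<succ⇒≤ {x} {y} p with <-or-≥ y x
... | inj₁ y<x = ⊥-elim (<⇒≱ p (succ-least y<x))
... | inj₂ x≤y = x≤y

-- init a removes the last term of a, so that a = init a + ω^{ℓ a}.
init : Tm → Tm
init 𝟎 = 𝟎
init (ω^ a + 𝟎) = 𝟎
init (ω^ a + (ω^ c + d)) = ω^ a + init (ω^ c + d)

init-cnf : ∀ {x} → IsCNF x → IsCNF (init x)
init-cnf cnf-zero = cnf-zero
init-cnf (cnf-one _) = cnf-zero
init-cnf (cnf-more {d = 𝟎} ha _ _) = cnf-one ha
init-cnf (cnf-more {d = ω^ e + f} ha hcd c≤a) = cnf-more ha (init-cnf hcd) c≤a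

init-succ : ∀ {a} → IsCNF a → a ≢ 𝟎 → ℓ a ≡ 𝟎 → a ≡ succ (init a)
init-succ cnf-zero a≢0 _ = ⊥-elim (a≢0 refl)
init-succ (cnf-one _) _ refl = refl
init-succ (cnf-more {a} _ hcd _) _ ℓ≡0 = cong (ω^ a +_) (init-succ hcd (λ ()) ℓ≡0)

init-succ< : ∀ {a} → IsCNF a → a ≢ 𝟎 → ℓ a ≢ 𝟎 → succ (init a) <ₒ a
init-succ< cnf-zero a≢0 _ = ⊥-elim (a≢0 refl)
init-succ< (cnf-one {𝟎} _) _ ℓ≢0 = ⊥-elim (ℓ≢0 refl)
init-succ< (cnf-one {ω^ _ + _} _) _ _ = <-exp <-zero
init-succ< (cnf-more _ hcd _) _ ℓ≢0 = <-tail (init-succ< hcd (λ ()) ℓ≢0)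

init-gap : ∀ {a x} → IsCNF a → IsCNF x → init a <ₒ x → x <ₒ a → ℓ x <ₒ ℓ a
init-gap (cnf-one _) hx <-zero (<-exp p) = ≤-<-trans (ℓ≤lead hx) p
init-gap (cnf-more _ _ _) _ (<-exp p) (<-exp q) = ⊥-elim (<-irrefl (<-trans p q))
init-gap (cnf-more _ _ _) _ (<-exp p) (<-tail _) = ⊥-elim (<-irrefl p)
init-gap (cnf-more _ _ _) _ (<-tail _) (<-exp q) = ⊥-elim (<-irrefl q)
init-gap {ω^ e + (ω^ c + d)} {ω^ .e + g} (cnf-more _ hcd _) hx (<-tail p) (<-tail q) =
  subst (_<ₒ ℓ (ω^ c + d)) (sym (ℓ-cons e g (above⇒≢𝟎 p))) (init-gap hcd (cnf-tail hx) p q)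

data Shape (a : Tm) : Set where
  successor : (a′ : Tm) → IsCNF a′ → a ≡ succ a′ → Shape a
  limit     : ℓ a ≢ 𝟎 → Shape a

shape : ∀ {a} → IsCNF a → a ≢ 𝟎 → Shape a
shape {a} ha a≢0 with ℓ a in ℓa
... | 𝟎 = successor (init a) (init-cnf ha) (init-succ ha a≢0 ℓa)
... | ω^ c + d = limit (λ ℓa≡0 → above⇒≢𝟎 <-zero (trans (sym ℓa) ℓa≡0))

max : Tm → Tm → Tm
max a b with <-or-≥ a b
... | inj₁ _ = b
... | inj₂ _ = a

max-l : ∀ a b → a ≤ₒ max a b
max-l a b with <-or-≥ a b
... | inj₁ a<b = inj₁ a<b
... | inj₂ _ = inj₂ refl

max-r : ∀ a b → b ≤ₒ max a b
max-r a b with <-or-≥ a b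
... | inj₁ _ = inj₂ refl
... | inj₂ b≤a = b≤a

max-lub : ∀ {a b x} → a ≤ₒ x → b ≤ₒ x → max a b ≤ₒ x
max-lub {a} {b} p q with <-or-≥ a b
... | inj₁ _ = q
... | inj₂ _ = p

max-cnf : ∀ {a b} → IsCNF a → IsCNF b → IsCNF (max a b)
max-cnf {a} {b} p q with <-or-≥ a b
... | inj₁ _ = q
... | inj₂ _ = p

-- The ordinal sum m + ω^d: terms of m below ω^d are absorbed.
infixl 25 _+ω^_

_+ω^_ : Tm → Tm → Tm
𝟎 +ω^ d = ω^ d + 𝟎
(ω^ a + b) +ω^ d with <-or-≥ a d
... | inj₁ _ = ω^ d + 𝟎
... | inj₂ _ = ω^ a + (b +ω^ d)

+ω^-≢𝟎 : ∀ m d → m +ω^ d ≢ 𝟎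
+ω^-≢𝟎 𝟎 d ()
+ω^-≢𝟎 (ω^ a + b) d with <-or-≥ a d
... | inj₁ _ = λ ()
... | inj₂ _ = λ ()

ℓ-+ω^ : ∀ m d → ℓ (m +ω^ d) ≡ d
ℓ-+ω^ 𝟎 d = refl
ℓ-+ω^ (ω^ a + b) d with <-or-≥ a d
... | inj₁ _ = refl
... | inj₂ _ = trans (ℓ-cons a _ (+ω^-≢𝟎 b d)) (ℓ-+ω^ b d)

<+ω^ : ∀ m d → m <ₒ m +ω^ d
<+ω^ 𝟎 d = <-zero
<+ω^ (ω^ a + b) d with <-or-≥ a d
... | inj₁ a<d = <-exp a<d
... | inj₂ _ = <-tail (<+ω^ b d)

+ω^-leads : ∀ {a b d} → LeadsBelow a b → d ≤ₒ a → LeadsBelow a (b +ω^ d)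
+ω^-leads lb-zero d≤a = lb-cons d≤a
+ω^-leads {d = d} (lb-cons {c} c≤a) d≤a with <-or-≥ c d
... | inj₁ _ = lb-cons d≤a
... | inj₂ _ = lb-cons c≤a

+ω^-cnf : ∀ {m d} → IsCNF m → IsCNF d → IsCNF (m +ω^ d)
+ω^-cnf {𝟎} hm hd = cnf-one hd
+ω^-cnf {ω^ a + b} {d} hm hd with <-or-≥ a d
... | inj₁ _ = cnf-one hd
... | inj₂ d≤a = cnf-cons (cnf-head hm) (+ω^-cnf (cnf-tail hm) hd) (+ω^-leads (cnf-leads hm) d≤a)

+ω^-least : ∀ {m d x} → IsCNF x → m <ₒ x → d ≤ₒ ℓ x → m +ω^ d ≤ₒ x
+ω^-least {𝟎} hx <-zero d≤ℓx = ω^≤ (≤-trans d≤ℓx (ℓ≤lead hx))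
+ω^-least {ω^ a + b} {d} hx (<-exp p) d≤ℓx with <-or-≥ a d
... | inj₁ _ = ω^≤ (≤-trans d≤ℓx (ℓ≤lead hx))
... | inj₂ _ = inj₁ (<-exp p)
+ω^-least {ω^ a + b} {d} {ω^ .a + f} hx (<-tail p) d≤ℓx with <-or-≥ a d
... | inj₁ a<d = ⊥-elim (<⇒≱ a<d (≤-trans d≤ℓx (ℓ≤lead hx)))
... | inj₂ _ = tail≤ (+ω^-least (cnf-tail hx) p (subst (d ≤ₒ_) (ℓ-cons a f (above⇒≢𝟎 p)) d≤ℓx))

-- One step of the meet recursion: the least notation ≥ m whose last
-- exponent is ≥ d, namely m itself if ℓ m ≥ d and m + ω^d otherwise.
raise : Tm → Tm → Tm
raise m d with <-or-≥ (ℓ m) d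
... | inj₁ _ = m +ω^ d
... | inj₂ _ = m

raise-≥ : ∀ m d → m ≤ₒ raise m d
raise-≥ m d with <-or-≥ (ℓ m) d
... | inj₁ _ = inj₁ (<+ω^ m d)
... | inj₂ _ = inj₂ refl

raise-ℓ : ∀ m d → d ≤ₒ ℓ (raise m d)
raise-ℓ m d with <-or-≥ (ℓ m) d
... | inj₁ _ = inj₂ (sym (ℓ-+ω^ m d))
... | inj₂ d≤ℓm = d≤ℓm

raise-cnf : ∀ {m d} → IsCNF m → IsCNF d → IsCNF (raise m d)
raise-cnf {m} {d} hm hd with <-or-≥ (ℓ m) d
... | inj₁ _ = +ω^-cnf hm hd
... | inj₂ _ = hm

raise-least : ∀ {m d x} → IsCNF x → m ≤ₒ x → d ≤ₒ ℓ x → raise m d ≤ₒ x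
raise-least {m} {d} hx m≤x d≤ℓx with <-or-≥ (ℓ m) d
... | inj₂ _ = m≤x
... | inj₁ ℓm<d with m≤x
...   | inj₁ m<x = +ω^-least hx m<x d≤ℓx
...   | inj₂ refl = ⊥-elim (<⇒≱ ℓm<d d≤ℓx)

-- Height of the exponent tower; it strictly drops along an Ignatiev
-- sequence until the sequence reaches 0.
height : Tm → ℕ
height 𝟎 = 0
height (ω^ a + b) = suc (height a)

height-mono : ∀ {a b} → a ≤ₒ b → height a ≤ height b
height-mono (inj₂ refl) = ℕ.≤-refl
height-mono (inj₁ <-zero) = z≤n
height-mono (inj₁ (<-exp p)) = s≤s (height-mono (inj₁ p))
height-mono (inj₁ (<-tail p)) = ℕ.≤-refl

height-ℓ : ∀ {x} → IsCNF x → height (ℓ x) ≤ pred (height x)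
height-ℓ cnf-zero = z≤n
height-ℓ hx@(cnf-one _) = height-mono (ℓ≤lead hx)
height-ℓ hx@(cnf-more _ _ _) = height-mono (ℓ≤lead hx)

height≡0 : ∀ {x} → height x ≤ 0 → x ≡ 𝟎
height≡0 {𝟎} _ = refl

vanish : ∀ (β : ISeq) k i → height (seq β i) ≤ k → seq β (i + k) ≡ 𝟎
vanish β zero i h = subst (λ j → seq β j ≡ 𝟎) (sym (ℕ.+-identityʳ i)) (height≡0 h)
vanish β (suc k) i h = subst (λ j → seq β j ≡ 𝟎) (sym (ℕ.+-suc i k)) (vanish β k (suc i) drop)
  where
  drop : height (seq β (suc i)) ≤ k
  drop = ℕ.≤-trans (height-mono (ladder β i))
           (ℕ.≤-trans (height-ℓ (cnf β i)) (ℕ.pred-mono-≤ h))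

eventually-𝟎 : ∀ (β : ISeq) j → height (seq β 0) ≤ j → seq β j ≡ 𝟎
eventually-𝟎 β j = vanish β j 0

-- The meet of β and γ: with top = max(β, γ) pointwise and N a point from
-- which top vanishes, δ_j is obtained from δ_N = 0 by N ∸ j raise-steps.
module Meet (β γ : ISeq) where
  top : ℕ → Tm
  top j = max (seq β j) (seq γ j)

  N : ℕ
  N = height (seq β 0) ⊔ height (seq γ 0)

  top-vanishes : ∀ j → N ≤ j → top j ≡ 𝟎
  top-vanishes j N≤j
    rewrite eventually-𝟎 β j (ℕ.≤-trans (ℕ.m≤m⊔n _ _) N≤j)
          | eventually-𝟎 γ j (ℕ.≤-trans (ℕ.m≤n⊔m _ _) N≤j) = refl

  -- fill k j: the value at j of the meet truncated to 0 at index j + k.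
  fill : ℕ → ℕ → Tm
  fill zero j = 𝟎
  fill (suc k) j = raise (top j) (fill k (suc j))

  fill-cnf : ∀ k j → IsCNF (fill k j)
  fill-cnf zero j = cnf-zero
  fill-cnf (suc k) j = raise-cnf (max-cnf (cnf β j) (cnf γ j)) (fill-cnf k (suc j))

  meetSeq : ℕ → Tm
  meetSeq j = fill (N ∸ j) j

  steps-suc : ∀ j → pred (N ∸ j) ≡ N ∸ suc j
  steps-suc j = ℕ.pred[m∸n]≡m∸[1+n] N j

  -- Each entry is a raise of the next one, so the ladder condition holds.
  meet-ladder : ∀ j → meetSeq (suc j) ≤ₒ ℓ (meetSeq j)
  meet-ladder j with N ∸ j | steps-suc j
  ... | zero | N∸j+1≡0 rewrite sym N∸j+1≡0 = inj₂ refl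
  ... | suc k | N∸j+1≡k rewrite sym N∸j+1≡k = raise-ℓ (top j) (fill k (suc j))

  meet : ISeq
  meet = record { seq = meetSeq ; cnf = λ j → fill-cnf (N ∸ j) j ; ladder = meet-ladder }

  top≤meet : ∀ j → top j ≤ₒ meetSeq j
  top≤meet j with N ∸ j in N∸j
  ... | zero rewrite top-vanishes j (ℕ.m∸n≡0⇒m≤n N∸j) = inj₂ refl
  ... | suc k = raise-≥ (top j) (fill k (suc j))

  fill-least : ∀ (ε : ISeq) → ε ≤𝔍 β → ε ≤𝔍 γ → ∀ k j → fill k j ≤ₒ seq ε j
  fill-least ε ε≤β ε≤γ zero j = 0≤ _
  fill-least ε ε≤β ε≤γ (suc k) j =
    raise-least (cnf ε j) (max-lub (ε≤β j) (ε≤γ j))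
      (≤-trans (fill-least ε ε≤β ε≤γ k (suc j)) (ladder ε j))

  isMeet : IsMeet meet β γ
  isMeet = (λ j → ≤-trans (max-l (seq β j) (seq γ j)) (top≤meet j))
         , (λ j → ≤-trans (max-r (seq β j) (seq γ j)) (top≤meet j))
         , (λ ε ε≤β ε≤γ j → fill-least ε ε≤β ε≤γ (N ∸ j) j)

fin≤fin⁻¹ : ∀ {a b} → fin a ≤̄ fin b → a ≤ₒ b
fin≤fin⁻¹ (fin≤fin p) = p

fin-injective : ∀ {a b} → fin a ≡ fin b → a ≡ b
fin-injective refl = refl

≤ε₀ : ∀ y → y ≤̄ ε₀
≤ε₀ (fin _) = fin≤ε₀
≤ε₀ ε₀ = ε₀≤ε₀

limit-isLimit : ∀ {a} → a ≢ 𝟎 → ℓ a ≢ 𝟎 → IsLimit (fin a)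
limit-isLimit a≢0 ℓa≢0 =
  (λ e → a≢0 (fin-injective e)) ,
  (λ b _ e → ℓa≢0 (trans (cong ℓ (fin-injective e)) (ℓ-succ b)))

module _ {F : ISeq → Set} (filt : IsFilter F) where
  open IsFilter filt

  below-sup : ∀ {j a β} → IsSupAt F j (fin a) → F β → seq β j <ₒ a
  below-sup (_ , ub , _) Fβ = <-≤-trans (<succ _) (fin≤fin⁻¹ (ub _ Fβ))

  sup≢𝟎 : ∀ {j a} → IsSupAt F j (fin a) → a ≢ 𝟎
  sup≢𝟎 sup = above⇒≢𝟎 (below-sup sup (proj₂ nonempty))

  sup≤ : ∀ {j x b} → IsSupAt F j x → IsCNF b → (∀ β → F β → seq β j <ₒ b) → x ≤̄ fin b
  sup≤ (_ , _ , least) hb bound = least (fin _) hb (λ β Fβ → fin≤fin (succ-least (bound β Fβ)))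

  -- Merging β and γ through their meet: β_i is bounded by a notation x
  -- below the supremum a whose last exponent dominates γ_{i+1}.
  interpolate : ∀ {i a β γ} → IsSupAt F i (fin a) → F β → F γ →
    Σ Tm (λ x → IsCNF x × seq β i ≤ₒ x × x <ₒ a × seq γ (suc i) ≤ₒ ℓ x)
  interpolate {i} {β = β} {γ} sup Fβ Fγ =
    seq δ i , cnf δ i , proj₁ δ-meet i , below-sup sup Fδ ,
    ≤-trans (proj₁ (proj₂ δ-meet) (suc i)) (ladder δ i)
    where
    δ = Meet.meet β γ
    δ-meet = Meet.isMeet β γ
    Fδ = meet-closed β γ δ Fβ Fγ δ-meet

  successor-bound : ∀ {i a′ γ} → IsSupAt F i (fin (succ a′)) → IsCNF a′ → F γ →
    seq γ (suc i) ≤ₒ ℓ a′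
  successor-bound {i} {a′} {γ} sup ha′ Fγ with <-or-≥ (ℓ a′) (seq γ (suc i))
  ... | inj₂ γ≤ℓa′ = γ≤ℓa′
  ... | inj₁ ℓa′<γ = ⊥-elim (<⇒≱ (<succ a′) (fin≤fin⁻¹ (sup≤ sup ha′ below-a′)))
    where
    below-a′ : ∀ β → F β → seq β i <ₒ a′
    below-a′ β Fβ with interpolate sup Fβ Fγ
    ... | x , _ , β≤x , x<a , γ≤ℓx with <succ⇒≤ x<a
    ...   | inj₁ x<a′ = ≤-<-trans β≤x x<a′
    ...   | inj₂ refl = ⊥-elim (<⇒≱ ℓa′<γ γ≤ℓx)

  limit-bound : ∀ {i a γ} → IsSupAt F i (fin a) → ℓ a ≢ 𝟎 → F γ → seq γ (suc i) <ₒ ℓ a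
  limit-bound {i} {a} {γ} sup@(ha , _) ℓa≢0 Fγ with <-or-≥ (seq γ (suc i)) (ℓ a)
  ... | inj₁ γ<ℓa = γ<ℓa
  ... | inj₂ ℓa≤γ = ⊥-elim (<⇒≱ (init-succ< ha (sup≢𝟎 sup) ℓa≢0)
                      (fin≤fin⁻¹ (sup≤ sup (succ-cnf (init-cnf ha)) below-init)))
    where
    below-init : ∀ β → F β → seq β i <ₒ succ (init a)
    below-init β Fβ with interpolate sup Fβ Fγ
    ... | x , hx , β≤x , x<a , γ≤ℓx with <-or-≥ (init a) x
    ...   | inj₁ init<x = ⊥-elim (<⇒≱ (init-gap ha hx init<x x<a) (≤-trans ℓa≤γ γ≤ℓx))
    ...   | inj₂ x≤init = ≤-<-trans (≤-trans β≤x x≤init) (<succ (init a))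

mainTheorem4 : (F : ISeq → Set) → IsFilter F →
    (α : ℕ → Ō) → (∀ i → IsSupAt F i (α i)) →
    ∀ i → (IsLimit (α i) × (α (suc i) ≤̄ ℓ̄ (α i)))
    ⊎ Σ Tm (λ α′ → IsCNF α′ × (α i ≡ fin (succ α′)) × (α (suc i) ≤̄ fin (succ (ℓ α′))))
mainTheorem4 F filt α sup i with α i | sup i
... | ε₀ | _ = inj₁ (((λ ()) , (λ _ _ ())) , ≤ε₀ (α (suc i)))
... | fin a | supᵢ@(ha , _) with shape ha (sup≢𝟎 filt supᵢ)
...   | successor a′ ha′ refl =
        inj₂ (a′ , ha′ , refl ,
              sup≤ filt (sup (suc i)) (succ-cnf (ℓ-cnf ha′))
                (λ γ Fγ → ≤-<-trans (successor-bound filt supᵢ ha′ Fγ) (<succ (ℓ a′))))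
...   | limit ℓa≢0 =
        inj₁ (limit-isLimit (sup≢𝟎 filt supᵢ) ℓa≢0 ,
              sup≤ filt (sup (suc i)) (ℓ-cnf ha) (λ γ Fγ → limit-bound filt supᵢ ℓa≢0 Fγ))
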